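{- Let $G$ be a graph with possible loops and let $C: v_0v_1\dots v_k$ ($v_k=v_0$), $k\ge5$, be a cycle in $G$ (so $v_0,\dots,v_{k-1}$ are distinct and consecutive vertices are adjacent) such that $v_0$ is the only vertex of $C$ with a loop. Suppose that the walk $v_0v_1\dots v_{k-1}$ has no strong chords. Then either $k$ is odd and $v_0v_j\in E(G)$ for all even $j<k$, or $G$ contains an induced subgraph belonging to $\mathcal F_2\cup\mathcal F_3\cup\mathcal F_5$.
   Context: A graph with possible loops is an undirected graph in which each vertex may or may not carry a loop (a loop at $v$ is the edge $vv$). A strong chord of a (not necessarily closed) walk $v_0v_1\dots v_m$ is an edge $v_iv_j$ of $G$ (possibly a loop if $v_i=v_j$) such that $j-i$ is odd and $j-i\neq\pm1$ (difference computed in the integers). Induced subgraphs preserve loops. "The $n$-cycle" has vertices $0,\dots,n-1$ and edges $\{i,i+1\}$ mod $n$; each listed graph has exactly the stated edges and loops. $\mathcal F_2$: the $n$-cycle, $n\ge3$, $n\ne4$, no loops. $\mathcal F_3$: the $n$-cycle, $n\ge5$, with a loop only at $0$. $\mathcal F_5$: the $n$-cycle, $n\ge6$ even, with a loop only at $0$, plus edges $\{0,i\}$ for all even $i$ with $2\le i\le n-2$. -}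

module Defs where

open import Data.Nat using (ℕ; zero; suc; _∸_; _≤_; _<_; _%_)
open import Data.Nat.Properties using (_≟_)
open import Data.Bool using (Bool; true; false; _∧_; _∨_)
open import Data.Fin using (Fin; toℕ)
open import Data.Product using (Σ; _×_)
open import Data.Sum using (_⊎_)
open import Relation.Nullary using (¬_)
open import Relation.Nullary.Decidable using (⌊_⌋)
open import Relation.Binary.PropositionalEquality using (_≡_; _≢_)
open import Function.Definitions using (Injective)

record Graph : Set where
  field
    size : ℕ
    adj  : Fin size → Fin size → Bool
    sym  : ∀ u v → adj u v ≡ adj v u
open Graph public

_==_ : ℕ → ℕ → Bool
a == b = ⌊ a ≟ b ⌋

_≤ᵇ_ : ℕ → ℕ → Bool
a ≤ᵇ b = ⌊ Data.Nat.Properties._≤?_ a b ⌋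

isEven : ℕ → Bool
isEven a = (a % 2) == 0

Odd : ℕ → Set
Odd a = a % 2 ≡ 1

Even : ℕ → Set
Even a = a % 2 ≡ 0

cycAdj : (n : ℕ) → Fin n → Fin n → Bool
cycAdj n i j =
  (suc (toℕ i) == toℕ j) ∨ (suc (toℕ j) == toℕ i)
  ∨ ((toℕ i == (n ∸ 1)) ∧ (toℕ j == 0))
  ∨ ((toℕ j == (n ∸ 1)) ∧ (toℕ i == 0))

loop0 : (n : ℕ) → Fin n → Fin n → Bool
loop0 n i j = (toℕ i == 0) ∧ (toℕ j == 0)

fanAdj : (n : ℕ) → Fin n → Fin n → Bool
fanAdj n i j = spoke i j ∨ spoke j i
  where
  spoke : Fin n → Fin n → Bool
  spoke a b = (toℕ a == 0) ∧ isEven (toℕ b) ∧ (2 ≤ᵇ toℕ b) ∧ (toℕ b ≤ᵇ (n ∸ 2))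

F2adj F3adj F5adj : (n : ℕ) → Fin n → Fin n → Bool
F2adj n = cycAdj n
F3adj n i j = cycAdj n i j ∨ loop0 n i j
F5adj n i j = cycAdj n i j ∨ loop0 n i j ∨ fanAdj n i j

F2size F3size F5size : ℕ → Set
F2size n = (3 ≤ n) × (n ≢ 4)
F3size n = 5 ≤ n
F5size n = (6 ≤ n) × Even n

-- G has an induced subgraph isomorphic to the graph on Fin m with adjacency H
-- (loops preserved: the condition includes i ≡ j)
InducedCopy : (G : Graph) (m : ℕ) → (Fin m → Fin m → Bool) → Set
InducedCopy G m H =
  Σ (Fin m → Fin (size G)) λ f →
    Injective _≡_ _≡_ f × (∀ i j → adj G (f i) (f j) ≡ H i j)

HasInducedF235 : Graph → Set
HasInducedF235 G = Σ ℕ λ m →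
     (F2size m × InducedCopy G m (F2adj m))
   ⊎ (F3size m × InducedCopy G m (F3adj m))
   ⊎ (F5size m × InducedCopy G m (F5adj m))

{-# OPTIONS --safe #-}
-- If some chord v_x v_y avoids v₀ (0 < x, x + 2 ≤ y), one of minimal length y − x spans the induced
-- loopless cycle v_x … v_y, of length y − x + 1 ≠ 4 because a chord of length 3 is strong: a member
-- of F₂.  Otherwise k is odd, as v₀v_{k−1} is not a strong chord; and if some even j has no spoke
-- v₀v_j, the spokes a < j < b nearest to j (v₀v₁ and v₀v_{k−1} are spokes) close the induced cycle
-- v₀ v_a … v_b whose only loop is at v₀.  As v₀v_{j+1} would be a strong chord, b ≥ j + 2, so this
-- cycle has length at least 5: a member of F₃.
module Submission where

open import Defs hiding (sym)
open import Data.Nat using (ℕ; zero; suc; _+_; _∸_; _%_; _≤_; _<_; z≤n; s≤s; s≤s⁻¹; _<?_; NonZero)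
open import Data.Nat.Properties
open import Data.Nat.DivMod using (_mod_; m<n⇒m%n≡m)
open import Data.Nat.Induction using (<-wellFounded)
open import Data.Bool using (Bool; true; false; _∧_; _∨_)
import Data.Bool.Properties as Bool
open import Data.Fin using (Fin; toℕ; zero; suc)
open import Data.Fin.Properties using (toℕ-injective; toℕ<n; toℕ≤pred[n]; toℕ-fromℕ<)
open import Data.Product using (_×_; _,_; ∃; ∃₂)
import Data.Product as Product
open import Data.Sum using (_⊎_; inj₁; inj₂)
import Data.Sum as Sum
open import Function.Definitions using (Injective)
open import Induction.WellFounded using (Acc; acc)
open import Relation.Nullary using (¬_; Dec; yes; no; contradiction)
open import Relation.Nullary.Decidable
  using (_×-dec_; ¬?; decidable-stable; isYes≗does; dec-true; dec-false)
open import Relation.Unary using (Pred; Decidable)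
open import Relation.Binary.Definitions using (tri<; tri≈; tri>)
open import Relation.Binary.PropositionalEquality
  using (_≡_; _≢_; refl; sym; trans; cong; cong₂; subst; subst₂; module ≡-Reasoning)

==-true : ∀ {a b} → a ≡ b → (a == b) ≡ true
==-true {a} {b} a≡b = trans (isYes≗does (a ≟ b)) (dec-true (a ≟ b) a≡b)

==-false : ∀ {a b} → a ≢ b → (a == b) ≡ false
==-false {a} {b} a≢b = trans (isYes≗does (a ≟ b)) (dec-false (a ≟ b) a≢b)

∨-false : ∀ {x y} → x ≡ false → y ≡ false → x ∨ y ≡ false
∨-false refl refl = refl

∨-trueʳ : ∀ x {y} → y ≡ true → x ∨ y ≡ true
∨-trueʳ x refl = Bool.∨-zeroʳ x

∨-swap-pairs : ∀ a b c d → a ∨ b ∨ c ∨ d ≡ b ∨ a ∨ d ∨ c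
∨-swap-pairs a b c d = begin
  a ∨ (b ∨ (c ∨ d)) ≡⟨ Bool.∨-assoc a b (c ∨ d) ⟨
  (a ∨ b) ∨ (c ∨ d) ≡⟨ cong₂ _∨_ (Bool.∨-comm a b) (Bool.∨-comm c d) ⟩
  (b ∨ a) ∨ (d ∨ c) ≡⟨ Bool.∨-assoc b a (d ∨ c) ⟩
  b ∨ (a ∨ (d ∨ c)) ∎
  where open ≡-Reasoning

even⇒odd-suc : ∀ n → Even n → Odd (suc n)
even⇒odd-suc zero          _    = refl
even⇒odd-suc (suc (suc n)) even = even⇒odd-suc n even

even-suc⇒odd : ∀ n → Even (suc n) → Odd n
even-suc⇒odd (suc zero)    _    = refl
even-suc⇒odd (suc (suc n)) even = even-suc⇒odd n even

even⊎odd : ∀ n → Even n ⊎ Odd n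
even⊎odd zero          = inj₁ refl
even⊎odd (suc zero)    = inj₂ refl
even⊎odd (suc (suc n)) = even⊎odd n

n∸m<o : ∀ {m n o} → m < n → n ≤ o → ¬ (m ≡ 0 × n ≡ o) → n ∸ m < o
n∸m<o {zero}          _ n≤o ¬ends = ≤∧≢⇒< n≤o (λ n≡o → ¬ends (refl , n≡o))
n∸m<o {suc m} {suc n} _ n≤o _     = <-≤-trans (s≤s (m∸n≤m n m)) n≤o

suc[m+n]<m+o : ∀ m {n o} → suc n < o → suc (m + n) < m + o
suc[m+n]<m+o m {n} {o} n+1<o = subst (_< m + o) (+-suc m n) (+-monoʳ-< m n+1<o)

module _ {p} {P : Pred ℕ p} (P? : Decidable P) where

  least : ∀ {n} → P n → ∃ λ m → P m × (∀ {x} → x < m → ¬ P x)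
  least {n} = least-from (<-wellFounded n)
    where
    least-from : ∀ {n} → Acc _<_ n → P n → ∃ λ m → P m × (∀ {x} → x < m → ¬ P x)
    least-from {n} (acc smaller) pn with anyUpTo? P? n
    ... | yes (m , m<n , pm) = least-from (smaller m<n) pm
    ... | no ¬pm<n           = n , pn , λ x<n px → ¬pm<n (_ , x<n , px)

  greatest-below : ∀ {a} j → a < j → P a
    → ∃ λ m → a ≤ m × m < j × P m × (∀ {x} → m < x → x < j → ¬ P x)
  greatest-below (suc j) a<j+1 pa with P? j
  ... | yes pj = j , s≤s⁻¹ a<j+1 , ≤-refl , pj , λ j<x x<j+1 _ → <⇒≱ j<x (s≤s⁻¹ x<j+1)
  ... | no ¬pj with m<1+n⇒m<n∨m≡n a<j+1
  ...   | inj₂ refl = contradiction pa ¬pj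
  ...   | inj₁ a<j  with greatest-below j a<j pa
  ...     | m , a≤m , m<j , pm , gap = m , a≤m , m<n⇒m<1+n m<j , pm , gap′
    where
    gap′ : ∀ {x} → m < x → x < suc j → ¬ P x
    gap′ m<x x<j+1 with m<1+n⇒m<n∨m≡n x<j+1
    ... | inj₁ x<j  = gap m<x x<j
    ... | inj₂ refl = ¬pj

module _ {p} {P : Pred ℕ p} (P? : Decidable P) where

  gap-around : ∀ {a j b} → a < j → j < b → P a → P b → ¬ P j
    → ∃₂ λ a′ b′ → a ≤ a′ × a′ < j × j < b′ × b′ ≤ b × P a′ × P b′
                   × (∀ {x} → a′ < x → x < b′ → ¬ P x)
  gap-around {j = j} a<j j<b pa pb ¬pj
    with greatest-below P? j a<j pa | least (λ y → (j <? y) ×-dec P? y) (j<b , pb)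
  ... | a′ , a≤a′ , a′<j , pa′ , below | b′ , (j<b′ , pb′) , above =
    a′ , b′ , a≤a′ , a′<j , j<b′ , ≮⇒≥ (λ b<b′ → above b<b′ (j<b , pb)) , pa′ , pb′ , gap
    where
    gap : ∀ {x} → a′ < x → x < b′ → ¬ P x
    gap {x} a′<x x<b′ with <-cmp x j
    ... | tri< x<j _ _  = below a′<x x<j
    ... | tri≈ _ refl _ = ¬pj
    ... | tri> _ _ j<x  = λ px → above x<b′ (j<x , px)

cycAdj-suc : ∀ n {i j : Fin n} → suc (toℕ i) ≡ toℕ j → cycAdj n i j ≡ true
cycAdj-suc n i+1≡j rewrite ==-true i+1≡j = refl

cycAdj-closing : ∀ n {i j : Fin n} → toℕ i ≡ 0 → toℕ j ≡ n ∸ 1 → cycAdj n i j ≡ true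
cycAdj-closing n {i} {j} i≡0 j≡n∸1 =
  ∨-trueʳ (suc (toℕ i) == toℕ j) (∨-trueʳ (suc (toℕ j) == toℕ i)
    (∨-trueʳ ((toℕ i == (n ∸ 1)) ∧ (toℕ j == 0)) (cong₂ _∧_ (==-true j≡n∸1) (==-true i≡0))))

cycAdj-nonadjacent : ∀ n {i j : Fin n} → suc (toℕ i) < toℕ j
  → ¬ (toℕ i ≡ 0 × toℕ j ≡ n ∸ 1) → cycAdj n i j ≡ false
cycAdj-nonadjacent n {i} {j} i+1<j ¬closing =
  ∨-false (==-false (<⇒≢ i+1<j))
    (∨-false (==-false (λ j+1≡i → <-asym i<j (≤-reflexive j+1≡i)))
      (∨-false reversed-closing closing))
  where
  i<j : toℕ i < toℕ j
  i<j = <-trans (n<1+n (toℕ i)) i+1<j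
  reversed-closing : ((toℕ i == (n ∸ 1)) ∧ (toℕ j == 0)) ≡ false
  reversed-closing rewrite ==-false (>⇒≢ (≤-<-trans z≤n i<j)) = Bool.∧-zeroʳ (toℕ i == (n ∸ 1))
  closing : ((toℕ j == (n ∸ 1)) ∧ (toℕ i == 0)) ≡ false
  closing with toℕ i ≟ 0
  ... | no _ = Bool.∧-zeroʳ (toℕ j == (n ∸ 1))
  ... | yes i≡0 rewrite ==-false (λ j≡n∸1 → ¬closing (i≡0 , j≡n∸1)) = refl

cycAdj-irrefl : ∀ n {i : Fin n} → 2 ≤ n → cycAdj n i i ≡ false
cycAdj-irrefl n {i} 2≤n = ∨-false i+1≢i (∨-false i+1≢i (∨-false ends ends))
  where
  i+1≢i : (suc (toℕ i) == toℕ i) ≡ false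
  i+1≢i = ==-false 1+n≢n
  ends : ((toℕ i == (n ∸ 1)) ∧ (toℕ i == 0)) ≡ false
  ends with toℕ i ≟ 0
  ... | no _ = Bool.∧-zeroʳ (toℕ i == (n ∸ 1))
  ... | yes i≡0 rewrite i≡0 | ==-false (<⇒≢ (∸-monoˡ-≤ 1 2≤n)) = refl

cycAdj-sym : ∀ n (i j : Fin n) → cycAdj n i j ≡ cycAdj n j i
cycAdj-sym n i j = ∨-swap-pairs (suc (toℕ i) == toℕ j) (suc (toℕ j) == toℕ i)
  ((toℕ i == (n ∸ 1)) ∧ (toℕ j == 0)) ((toℕ j == (n ∸ 1)) ∧ (toℕ i == 0))

F3adj-sym : ∀ n (i j : Fin n) → F3adj n i j ≡ F3adj n j i
F3adj-sym n i j = cong₂ _∨_ (cycAdj-sym n i j) (Bool.∧-comm (toℕ i == 0) (toℕ j == 0))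

module _ (G : Graph) {n : ℕ} (f : Fin n → Fin (size G)) where

  adj-from-< : {H : Fin n → Fin n → Bool} → (∀ i j → H i j ≡ H j i)
    → (∀ i → adj G (f i) (f i) ≡ H i i)
    → (∀ {i j} → toℕ i < toℕ j → adj G (f i) (f j) ≡ H i j)
    → ∀ i j → adj G (f i) (f j) ≡ H i j
  adj-from-< H-sym diagonal upper i j with <-cmp (toℕ i) (toℕ j)
  ... | tri< i<j _ _ = upper i<j
  ... | tri≈ _ i≡j _ rewrite toℕ-injective i≡j = diagonal j
  ... | tri> _ _ j<i = trans (Graph.sym G (f i) (f j)) (trans (upper j<i) (H-sym j i))

  CycleAdjacency : Set
  CycleAdjacency = ∀ {i j} → toℕ i < toℕ j → adj G (f i) (f j) ≡ cycAdj n i j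

  cycleAdjacency :
      (∀ {i j} → suc (toℕ i) ≡ toℕ j → adj G (f i) (f j) ≡ true)
    → (∀ {i j} → toℕ i ≡ 0 → toℕ j ≡ n ∸ 1 → adj G (f i) (f j) ≡ true)
    → (∀ {i j} → suc (toℕ i) < toℕ j → ¬ (toℕ i ≡ 0 × toℕ j ≡ n ∸ 1) → adj G (f i) (f j) ≡ false)
    → CycleAdjacency
  cycleAdjacency step closing chords {i} {j} i<j with m≤n⇒m<n∨m≡n i<j
  ... | inj₂ i+1≡j = trans (step i+1≡j) (sym (cycAdj-suc n i+1≡j))
  ... | inj₁ i+1<j = by-closing ((toℕ i ≟ 0) ×-dec (toℕ j ≟ n ∸ 1))
    where
    by-closing : Dec (toℕ i ≡ 0 × toℕ j ≡ n ∸ 1) → adj G (f i) (f j) ≡ cycAdj n i j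
    by-closing (yes (i≡0 , j≡n∸1)) =
      trans (closing i≡0 j≡n∸1) (sym (cycAdj-closing n i≡0 j≡n∸1))
    by-closing (no ¬closing) =
      trans (chords i+1<j ¬closing) (sym (cycAdj-nonadjacent n i+1<j ¬closing))

  cycle∈F2 : 3 ≤ n → n ≢ 4 → Injective _≡_ _≡_ f → (∀ i → adj G (f i) (f i) ≡ false)
    → CycleAdjacency → HasInducedF235 G
  cycle∈F2 3≤n n≢4 f-injective loopless cycle =
    n , inj₁ ((3≤n , n≢4) , f , f-injective , adj-from-< (cycAdj-sym n) diagonal cycle)
    where
    diagonal : ∀ i → adj G (f i) (f i) ≡ cycAdj n i i
    diagonal i = trans (loopless i) (sym (cycAdj-irrefl n {i} (≤-trans (n≤1+n 2) 3≤n)))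

  cycle∈F3 : 5 ≤ n → Injective _≡_ _≡_ f → (∀ i → adj G (f i) (f i) ≡ (toℕ i == 0))
    → CycleAdjacency → HasInducedF235 G
  cycle∈F3 5≤n f-injective loops cycle =
    n , inj₂ (inj₁ (5≤n , f , f-injective , adj-from-< (F3adj-sym n) diagonal upper))
    where
    open ≡-Reasoning
    diagonal : ∀ i → adj G (f i) (f i) ≡ F3adj n i i
    diagonal i = begin
      adj G (f i) (f i)    ≡⟨ loops i ⟩
      toℕ i == 0           ≡⟨ Bool.∧-idem (toℕ i == 0) ⟨
      loop0 n i i          ≡⟨ cong (_∨ loop0 n i i) (cycAdj-irrefl n {i} (≤-trans (s≤s (s≤s z≤n)) 5≤n)) ⟨
      F3adj n i i          ∎
    upper : ∀ {i j} → toℕ i < toℕ j → adj G (f i) (f j) ≡ F3adj n i j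
    upper {i} {j} i<j = begin
      adj G (f i) (f j)    ≡⟨ cycle i<j ⟩
      cycAdj n i j         ≡⟨ Bool.∨-identityʳ (cycAdj n i j) ⟨
      cycAdj n i j ∨ false ≡⟨ cong (cycAdj n i j ∨_) no-loop ⟨
      F3adj n i j          ∎
      where
      no-loop : loop0 n i j ≡ false
      no-loop rewrite ==-false (>⇒≢ (≤-<-trans z≤n i<j)) = Bool.∧-zeroʳ (toℕ i == 0)

module LoopedCycle
  (G : Graph) (k : ℕ) (5≤k : 5 ≤ k) (w : ℕ → Fin (size G))
  (w-injective : ∀ {x y} → x < k → y < k → w x ≡ w y → x ≡ y)
  (path-edge : ∀ {x} → suc x < k → adj G (w x) (w (suc x)) ≡ true)
  (closing-edge : adj G (w 0) (w (k ∸ 1)) ≡ true)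
  (loop-at-0 : adj G (w 0) (w 0) ≡ true)
  (loopless : ∀ {x} → 0 < x → x < k → adj G (w x) (w x) ≡ false)
  (no-strong-chord : ∀ {x d} → x + d < k → 1 < d → Odd d → adj G (w x) (w (x + d)) ≡ false)
  where

  consecutive-edge : ∀ {x y} → suc x ≡ y → y < k → adj G (w x) (w y) ≡ true
  consecutive-edge refl = path-edge

  suc[k∸1]≡k : suc (k ∸ 1) ≡ k
  suc[k∸1]≡k = m+[n∸m]≡n (≤-trans (s≤s z≤n) 5≤k)

  k∸1<k : k ∸ 1 < k
  k∸1<k = ≤-reflexive suc[k∸1]≡k

  k-odd : Odd k
  k-odd with even⊎odd k
  ... | inj₂ odd-k  = odd-k
  ... | inj₁ even-k = contradiction (no-strong-chord k∸1<k 1<k∸1 odd-k∸1) (Bool.not-¬ closing-edge)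
    where
    1<k∸1 : 1 < k ∸ 1
    1<k∸1 = ∸-monoˡ-≤ 1 (≤-trans (s≤s (s≤s (s≤s z≤n))) 5≤k)
    odd-k∸1 : Odd (k ∸ 1)
    odd-k∸1 = even-suc⇒odd (k ∸ 1) (subst Even (sym suc[k∸1]≡k) even-k)

  -- The bound x < k is implied by x + d < k; it is the shape that anyUpTo? decides.
  Chord : ℕ → Set
  Chord d = 1 < d × ∃ λ x → x < k × 0 < x × x + d < k × adj G (w x) (w (x + d)) ≡ true

  chord? : ∀ d → Dec (Chord d)
  chord? d = (1 <? d) ×-dec anyUpTo? (λ x → (0 <? x) ×-dec (x + d <? k) ×-dec
                                       (adj G (w x) (w (x + d)) Bool.≟ true)) k

  chord-between : ∀ {x y} → 0 < x → suc x < y → y < k → adj G (w x) (w y) ≡ true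
    → Chord (y ∸ x)
  chord-between {x} {y} 0<x x+1<y y<k xy =
    1<y∸x , x , <-trans (<-trans (n<1+n x) x+1<y) y<k , 0<x ,
    subst (_< k) (sym x+[y∸x]≡y) y<k , subst (λ z → adj G (w x) (w z) ≡ true) (sym x+[y∸x]≡y) xy
    where
    x+[y∸x]≡y : x + (y ∸ x) ≡ y
    x+[y∸x]≡y = m+[n∸m]≡n (<⇒≤ (<-trans (n<1+n x) x+1<y))
    1<y∸x : 1 < y ∸ x
    1<y∸x = subst (_≤ y ∸ x) (m+n∸n≡m 2 x) (∸-monoˡ-≤ x x+1<y)

  shortest-chord⇒F2 : ∀ {x d} → 1 < d → 0 < x → x + d < k → adj G (w x) (w (x + d)) ≡ true
    → (∀ {d′} → d′ < d → ¬ Chord d′) → HasInducedF235 G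
  shortest-chord⇒F2 {x} {d} 1<d 0<x x+d<k chord shortest =
    cycle∈F2 G f (s≤s 1<d) suc[d]≢4 f-injective (λ i → loopless (0<x+ i) (bound i))
      (cycleAdjacency G f step closing chordless)
    where
    f : Fin (suc d) → Fin (size G)
    f i = w (x + toℕ i)
    bound : ∀ i → x + toℕ i < k
    bound i = ≤-<-trans (+-monoʳ-≤ x (toℕ≤pred[n] i)) x+d<k
    0<x+ : ∀ i → 0 < x + toℕ i
    0<x+ i = <-≤-trans 0<x (m≤m+n x (toℕ i))
    suc[d]≢4 : suc d ≢ 4
    suc[d]≢4 refl = contradiction (no-strong-chord x+d<k 1<d refl) (Bool.not-¬ chord)
    f-injective : Injective _≡_ _≡_ f
    f-injective {i} {j} fi≡fj =
      toℕ-injective (+-cancelˡ-≡ x _ _ (w-injective (bound i) (bound j) fi≡fj))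
    step : ∀ {i j} → suc (toℕ i) ≡ toℕ j → adj G (f i) (f j) ≡ true
    step {i} {j} i+1≡j = consecutive-edge (trans (sym (+-suc x (toℕ i))) (cong (x +_) i+1≡j)) (bound j)
    closing : ∀ {i j} → toℕ i ≡ 0 → toℕ j ≡ d → adj G (f i) (f j) ≡ true
    closing i≡0 j≡d rewrite i≡0 | j≡d | +-identityʳ x = chord
    chordless : ∀ {i j} → suc (toℕ i) < toℕ j → ¬ (toℕ i ≡ 0 × toℕ j ≡ d) → adj G (f i) (f j) ≡ false
    chordless {i} {j} i+1<j ¬closing = Bool.¬-not λ xy →
      shortest (subst (_< d) (sym ([m+n]∸[m+o]≡n∸o x (toℕ j) (toℕ i))) shorter)
        (chord-between (0<x+ i) (suc[m+n]<m+o x i+1<j) (bound j) xy)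
      where
      shorter : toℕ j ∸ toℕ i < d
      shorter = n∸m<o (<-trans (n<1+n (toℕ i)) i+1<j) (toℕ≤pred[n] j) ¬closing

  no-chord⇒nonadjacent : ¬ (∃ λ d → d < k × Chord d)
    → ∀ {x y} → 0 < x → suc x < y → y < k → adj G (w x) (w y) ≡ false
  no-chord⇒nonadjacent ¬chord {x} {y} 0<x x+1<y y<k = Bool.¬-not λ xy →
    ¬chord (y ∸ x , ≤-<-trans (m∸n≤m y x) y<k , chord-between 0<x x+1<y y<k xy)

  Spoke : ℕ → Set
  Spoke x = adj G (w 0) (w x) ≡ true

  spoke? : ∀ x → Dec (Spoke x)
  spoke? x = adj G (w 0) (w x) Bool.≟ true

  module _ (chordless : ∀ {x y} → 0 < x → suc x < y → y < k → adj G (w x) (w y) ≡ false) where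

    spoke-gap⇒F3 : ∀ {a m} → 0 < a → 3 ≤ m → a + m < k → Spoke a → Spoke (a + m)
      → (∀ {x} → a < x → x < a + m → ¬ Spoke x) → HasInducedF235 G
    spoke-gap⇒F3 {a} {m} 0<a 3≤m a+m<k spoke-a spoke-a+m gap =
      cycle∈F3 G f (s≤s (s≤s 3≤m)) f-injective loops (cycleAdjacency G f step closing chords)
      where
      f : Fin (suc (suc m)) → Fin (size G)
      f zero    = w 0
      f (suc i) = w (a + toℕ i)
      bound : ∀ (i : Fin (suc m)) → a + toℕ i < k
      bound i = ≤-<-trans (+-monoʳ-≤ a (toℕ≤pred[n] i)) a+m<k
      0<a+ : ∀ (i : Fin (suc m)) → 0 < a + toℕ i
      0<a+ i = <-≤-trans 0<a (m≤m+n a (toℕ i))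
      0<k : 0 < k
      0<k = ≤-<-trans z≤n a+m<k
      f-injective : Injective _≡_ _≡_ f
      f-injective {zero}  {zero}  _     = refl
      f-injective {zero}  {suc j} f0≡fj = contradiction (w-injective 0<k (bound j) f0≡fj) (<⇒≢ (0<a+ j))
      f-injective {suc i} {zero}  fi≡f0 = contradiction (w-injective (bound i) 0<k fi≡f0) (>⇒≢ (0<a+ i))
      f-injective {suc i} {suc j} fi≡fj =
        cong suc (toℕ-injective (+-cancelˡ-≡ a _ _ (w-injective (bound i) (bound j) fi≡fj)))
      loops : ∀ i → adj G (f i) (f i) ≡ (toℕ i == 0)
      loops zero    = loop-at-0
      loops (suc i) = loopless (0<a+ i) (bound i)
      step : ∀ {i j} → suc (toℕ i) ≡ toℕ j → adj G (f i) (f j) ≡ true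
      step {zero}  {suc j} 1≡j+1 rewrite sym (suc-injective 1≡j+1) | +-identityʳ a = spoke-a
      step {suc i} {suc j} i+2≡j+2 =
        consecutive-edge (trans (sym (+-suc a (toℕ i))) (cong (a +_) (suc-injective i+2≡j+2))) (bound j)
      closing : ∀ {i j} → toℕ i ≡ 0 → toℕ j ≡ suc m → adj G (f i) (f j) ≡ true
      closing {zero} {suc j} _ j+1≡m+1 rewrite suc-injective j+1≡m+1 = spoke-a+m
      chords : ∀ {i j} → suc (toℕ i) < toℕ j → ¬ (toℕ i ≡ 0 × toℕ j ≡ suc m)
        → adj G (f i) (f j) ≡ false
      chords {zero}  {suc j} (s≤s 0<j) ¬closing = Bool.¬-not (gap (m<m+n a 0<j) (+-monoʳ-< a j<m))
        where
        j<m : toℕ j < m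
        j<m = ≤∧≢⇒< (toℕ≤pred[n] j) (λ j≡m → ¬closing (refl , cong suc j≡m))
      chords {suc i} {suc j} (s≤s i+1<j) _ = chordless (0<a+ i) (suc[m+n]<m+o a i+1<j) (bound j)

    missing-even-spoke⇒F3 : ∀ {j} → j < k → Even j → ¬ Spoke j → HasInducedF235 G
    missing-even-spoke⇒F3 {zero} _ _ ¬spoke-0 = contradiction loop-at-0 ¬spoke-0
    missing-even-spoke⇒F3 {j@(suc (suc _))} j<k even-j ¬spoke-j
      with gap-around spoke? (s≤s (s≤s z≤n)) j<k∸1 spoke-1 closing-edge ¬spoke-j
      where
      spoke-1 : Spoke 1
      spoke-1 = path-edge (≤-trans (s≤s (s≤s z≤n)) 5≤k)
      j<k∸1 : j < k ∸ 1
      j<k∸1 = ≤∧≢⇒< (s≤s⁻¹ (subst (j <_) (sym suc[k∸1]≡k) j<k))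
                     (λ j≡k∸1 → ¬spoke-j (subst Spoke (sym j≡k∸1) closing-edge))
    ... | a , b , 1≤a , a<j , j<b , b≤k∸1 , spoke-a , spoke-b , gap
      with m≤n⇒∃[o]m+o≡n (<⇒≤ (<-trans a<j j<b))
    ... | m , refl = spoke-gap⇒F3 1≤a 3≤m b<k spoke-a spoke-b gap
      where
      b<k : a + m < k
      b<k = ≤-<-trans b≤k∸1 k∸1<k
      j+1<b : suc j < a + m
      j+1<b = ≤∧≢⇒< j<b λ j+1≡b → contradiction
        (no-strong-chord (subst (_< k) (sym j+1≡b) b<k) (s≤s (s≤s z≤n)) (even⇒odd-suc j even-j))
        (Bool.not-¬ (subst Spoke (sym j+1≡b) spoke-b))
      3≤m : 3 ≤ m
      3≤m = +-cancelˡ-≤ a 3 m (≤-trans (≤-reflexive (+-comm a 3)) (≤-trans (s≤s (s≤s a<j)) j+1<b))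

  dichotomy : (Odd k × (∀ {x} → x < k → Even x → Spoke x)) ⊎ HasInducedF235 G
  dichotomy with anyUpTo? chord? k
  ... | yes (_ , _ , chord-d) with least chord? chord-d
  ...   | d , (1<d , x , _ , 0<x , x+d<k , xy) , shortest =
    inj₂ (shortest-chord⇒F2 1<d 0<x x+d<k xy shortest)
  dichotomy | no ¬chord with anyUpTo? (λ x → (x % 2 ≟ 0) ×-dec ¬? (spoke? x)) k
  ... | yes (j , j<k , even-j , ¬spoke-j) =
    inj₂ (missing-even-spoke⇒F3 (no-chord⇒nonadjacent ¬chord) j<k even-j ¬spoke-j)
  ... | no ¬missing = inj₁ (k-odd , λ {x} x<k even-x →
    decidable-stable (spoke? x) λ ¬spoke-x → ¬missing (x , x<k , even-x , ¬spoke-x))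

toℕ-mod : ∀ {x k} .{{_ : NonZero k}} → x < k → toℕ (x mod k) ≡ x
toℕ-mod x<k = trans (toℕ-fromℕ< _) (m<n⇒m%n≡m x<k)

module ModIndexed (G : Graph) {k : ℕ} .{{_ : NonZero k}} (v : Fin k → Fin (size G)) where

  w : ℕ → Fin (size G)
  w x = v (x mod k)

  w-toℕ : ∀ i → w (toℕ i) ≡ v i
  w-toℕ i = cong v (toℕ-injective (toℕ-mod (toℕ<n i)))

  w-injective : Injective _≡_ _≡_ v → ∀ {x y} → x < k → y < k → w x ≡ w y → x ≡ y
  w-injective v-injective x<k y<k wx≡wy =
    trans (sym (toℕ-mod x<k)) (trans (cong toℕ (v-injective wx≡wy)) (toℕ-mod y<k))

  loop-at : ∀ (P : ℕ → Set) {b} → (∀ i → P (toℕ i) → adj G (v i) (v i) ≡ b)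
    → ∀ {x} → x < k → P x → adj G (w x) (w x) ≡ b
  loop-at P h x<k px = h _ (subst P (sym (toℕ-mod x<k)) px)

  adj-at : ∀ (R : ℕ → ℕ → Set) {b} → (∀ i j → R (toℕ i) (toℕ j) → adj G (v i) (v j) ≡ b)
    → ∀ {x y} → x < k → y < k → R x y → adj G (w x) (w y) ≡ b
  adj-at R h x<k y<k r = h _ _ (subst₂ R (sym (toℕ-mod x<k)) (sym (toℕ-mod y<k)) r)

lemma7 : (G : Graph) (k : ℕ) → 5 ≤ k → (v : Fin k → Fin (size G))
    → Injective _≡_ _≡_ v
    → (∀ i j → suc (toℕ i) ≡ toℕ j → adj G (v i) (v j) ≡ true)
    → (∀ i j → toℕ i ≡ k ∸ 1 → toℕ j ≡ 0 → adj G (v i) (v j) ≡ true)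
    → (∀ i → toℕ i ≡ 0 → adj G (v i) (v i) ≡ true)
    → (∀ i → toℕ i ≢ 0 → adj G (v i) (v i) ≡ false)
    → (∀ i j → toℕ i < toℕ j → Odd (toℕ j ∸ toℕ i) → toℕ j ∸ toℕ i ≢ 1
    → adj G (v i) (v j) ≡ false)
    → (Odd k × (∀ i j → toℕ i ≡ 0 → Even (toℕ j) → adj G (v i) (v j) ≡ true))
    ⊎ HasInducedF235 G
lemma7 G k@(suc _) 5≤k v v-injective path closing loop loopless no-strong-chord =
  Sum.map₁ (Product.map₂ spokes)
    (LoopedCycle.dichotomy G k 5≤k w (w-injective v-injective) path-edge closing-edge
      (loop-at (_≡ 0) loop 0<k refl) (λ 0<x x<k → loop-at (_≢ 0) loopless x<k (>⇒≢ 0<x))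
      w-no-strong-chord)
  where
  open ModIndexed G v
  0<k : 0 < k
  0<k = ≤-trans (s≤s z≤n) 5≤k
  path-edge : ∀ {x} → suc x < k → adj G (w x) (w (suc x)) ≡ true
  path-edge x+1<k = adj-at (λ x y → suc x ≡ y) path (<-trans (n<1+n _) x+1<k) x+1<k refl
  closing-edge : adj G (w 0) (w (k ∸ 1)) ≡ true
  closing-edge = trans (Graph.sym G _ _)
    (adj-at (λ x y → x ≡ k ∸ 1 × y ≡ 0) (λ i j → Product.uncurry (closing i j)) ≤-refl 0<k (refl , refl))
  w-no-strong-chord : ∀ {x d} → x + d < k → 1 < d → Odd d → adj G (w x) (w (x + d)) ≡ false
  w-no-strong-chord {x} {d} x+d<k 1<d odd-d =
    adj-at (λ y z → y < z × Odd (z ∸ y) × z ∸ y ≢ 1)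
      (λ i j (i<j , odd , ≢1) → no-strong-chord i j i<j odd ≢1)
      (≤-<-trans (m≤m+n x d) x+d<k) x+d<k
      (m<m+n x (<-trans (s≤s z≤n) 1<d) , subst Odd (sym x+d∸x≡d) odd-d ,
       λ x+d∸x≡1 → >⇒≢ 1<d (trans (sym x+d∸x≡d) x+d∸x≡1))
    where
    x+d∸x≡d : x + d ∸ x ≡ d
    x+d∸x≡d = m+n∸m≡n x d
  spokes : (∀ {x} → x < k → Even x → adj G (w 0) (w x) ≡ true)
    → ∀ i j → toℕ i ≡ 0 → Even (toℕ j) → adj G (v i) (v j) ≡ true
  spokes spoke i j i≡0 even-j = subst₂ (λ a b → adj G a b ≡ true)
    (trans (cong w (sym i≡0)) (w-toℕ i)) (w-toℕ j) (spoke (toℕ<n j) even-j)
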